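{- Let $n\ge3$ and let $P$ be a monotone weakly separated path of $3$-subsets of $[n]$ from $\{1,2,3\}$ to $\{n-2,n-1,n\}$. Then there is no index $i$ such that all nine edges $\{i,i+1\}$, $\{i+1,i+2\}$, $\{i+2,i+3\}$, $\{i+3,i+4\}$, $\{i+4,i+5\}$, $\{i,i+2\}$, $\{i+1,i+3\}$, $\{i+2,i+4\}$, $\{i+3,i+5\}$ belong to the arc diagram $\mathbf{D}(P)$.
   Context: Two different $k$-subsets $I,J$ are weakly separated if $\max(I\setminus J)<\min(J\setminus I)$ or $\max(J\setminus I)<\min(I\setminus J)$. A monotone weakly separated path is a sequence $(A_0,\dots,A_N)$ of $k$-subsets, pairwise weakly separated, such that for each $i$, $A_i\setminus A_{i-1}=\{x_i\}$, $A_{i-1}\setminus A_i=\{y_i\}$ with $x_i>y_i$. The arc diagram $\mathbf{D}(P)$ is the simple graph on $[n]$ with edge $\{i,j\}$ if and only if $\{i,j\}=(A_{a-1}\setminus A_a)\cup(A_a\setminus A_{a-1})$ for some $a\in[N]$. -}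

module Defs where

open import Data.Nat using (ℕ; zero; suc; _<_; _≤_; _∸_; _+_)
open import Data.Fin using (Fin; toℕ; inject₁) renaming (suc to fsuc)
open import Data.List using (List; length; _∷_; [])
open import Data.List.Membership.Propositional using (_∈_; _∉_)
open import Data.List.Relation.Unary.All using (All)
open import Data.List.Relation.Unary.AllPairs using (AllPairs)
open import Data.Product using (Σ; ∃; ∃-syntax; _×_; _,_)
open import Data.Sum using (_⊎_)
open import Relation.Binary.PropositionalEquality using (_≡_)
open import Relation.Nullary using (¬_)

-- A finite subset of ℕ, represented by the list of its elements in strictly
-- increasing order (so each set has a unique representative).
FinSet : Set
FinSet = List ℕ

IsKSubset : ℕ → ℕ → FinSet → Set
IsKSubset n k S = AllPairs _<_ S × length S ≡ k × All (λ x → 1 ≤ x × x ≤ n) S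

_∈_∖_ : ℕ → FinSet → FinSet → Set
x ∈ I ∖ J = x ∈ I × x ∉ J

-- max(I∖J) < min(J∖I)   (both sets nonempty when I ≠ J have equal size)
MaxLtMin : FinSet → FinSet → Set
MaxLtMin I J = ∀ a b → a ∈ I ∖ J → b ∈ J ∖ I → a < b

WeaklySeparated : FinSet → FinSet → Set
WeaklySeparated I J = ¬ (I ≡ J) × (MaxLtMin I J ⊎ MaxLtMin J I)

MonotoneStep : FinSet → FinSet → ℕ → ℕ → Set
MonotoneStep B A x y =
  (∀ z → (z ∈ A ∖ B → z ≡ x) × (z ≡ x → z ∈ A ∖ B)) ×
  (∀ z → (z ∈ B ∖ A → z ≡ y) × (z ≡ y → z ∈ B ∖ A)) ×
  y < x

record MonotoneWSPath (n k N : ℕ) (A : Fin (suc N) → FinSet) : Set where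
  field
    kSubsets  : ∀ i → IsKSubset n k (A i)
    pairwiseWS : ∀ i j → ¬ (i ≡ j) → WeaklySeparated (A i) (A j)
    steps     : ∀ (a : Fin N) → ∃[ x ] ∃[ y ] MonotoneStep (A (inject₁ a)) (A (fsuc a)) x y

-- {p,q} is an edge of the arc diagram D(P): {p,q} = (A_{a-1}∖A_a) ∪ (A_a∖A_{a-1}).
ArcEdge : ∀ {N} → (Fin (suc N) → FinSet) → ℕ → ℕ → Set
ArcEdge {N} A p q = ∃[ a ] ∃[ x ] ∃[ y ]
  (MonotoneStep (A (inject₁ {N} a)) (A (fsuc a)) x y ×
   ((p ≡ x × q ≡ y) ⊎ (p ≡ y × q ≡ x)))

module Submission where

-- Along a monotone weakly separated path every set precedes every later one, in the sense
-- max (I ∖ J) < min (J ∖ I): for sets of equal size the reverse orientation would put each set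
-- elementwise below the other. Seen through the window [i, i + 5], a 3-subset becomes a triple of
-- codes in {0, …, 7} (0 and 7 absorbing everything left and right of the window), every arc of the
-- diagram inside the window becomes one of finitely many abstract exchange steps, and two steps at
-- different times must respect the precedence of their sets. A backtracking search over these
-- abstract steps shows that the eight arcs other than {i + 2, i + 3} already admit no consistent
-- choice.

open import Defs
open import Data.Bool using (Bool; true; T; _∧_)
open import Data.Bool.ListAction using (any; all)
open import Data.Bool.Properties using (T-∧)
open import Data.Fin as Fin using (Fin; zero; suc; toℕ; inject₁; fromℕ; fromℕ<; #_)
import Data.Fin.Properties as Fin
open import Data.List using (List; []; _∷_; [_]; length; map; upTo; filter; cartesianProduct; cartesianProductWith)
open import Data.List.Properties as List using (length-map)
open import Data.List.Membership.Propositional using (_∈_; _∉_; lose)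
open import Data.List.Membership.Propositional.Properties using (∈-map⁺; ∈-map⁻; ∈-upTo⁺; ∈-filter⁺; ∈-cartesianProductWith⁺; ∈-cartesianProduct⁺)
open import Data.List.Relation.Binary.Pointwise as Pointwise using (Pointwise; []; _∷_)
open import Data.List.Relation.Unary.All as All using (All; []; _∷_)
open import Data.List.Relation.Unary.All.Properties using (all⁻) renaming (map⁺ to All-map⁺)
open import Data.List.Relation.Unary.AllPairs as AllPairs using (AllPairs; []; _∷_; allPairs?)
import Data.List.Relation.Unary.AllPairs.Properties as AllPairs
open import Data.List.Relation.Unary.Any using (here; there)
open import Data.List.Relation.Unary.Any.Properties using (any⁺)
open import Data.Nat using (ℕ; zero; suc; _+_; _∸_; _⊓_; _≤_; _<_; _≤?_; _<?_; _≟_; z≤n; s≤s)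
open import Data.Nat.Properties
open import Data.List.Membership.DecPropositional _≟_ using (_∈?_)
open import Data.Product using (∃-syntax; _×_; _,_; proj₁; proj₂)
import Data.Product.Properties as Product
open import Data.Sum using (_⊎_; inj₁; inj₂)
open import Function using (_∘_; Equivalence)
open import Relation.Binary using (Decidable; Reflexive; Transitive; tri<; tri≈; tri>)
open import Relation.Binary.PropositionalEquality using (_≡_; _≢_; refl; sym; trans; cong; subst; subst₂; module ≡-Reasoning)
open import Relation.Nullary using (Dec; yes; no; ¬_; ¬?; _×-dec_; _⊎-dec_; _→-dec_; contradiction)
open import Relation.Nullary.Decidable using (True; isYes; fromWitness; toWitness)

private
  variable
    u v x y z z′ : ℕ
    I J B A : FinSet

head≤ : AllPairs _<_ (u ∷ I) → x ∈ u ∷ I → u ≤ x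
head≤ _          (here refl) = ≤-refl
head≤ (u<I ∷ _) (there x∈I) = <⇒≤ (All.lookup u<I x∈I)

head< : AllPairs _<_ (u ∷ I) → x ∈ I → u < x
head< (u<I ∷ _) = All.lookup u<I

∉-∷ : x ≢ u → x ∉ I → x ∉ u ∷ I
∉-∷ x≢u _   (here x≡u)  = x≢u x≡u
∉-∷ _   x∉I (there x∈I) = x∉I x∈I

separated-refl : MaxLtMin I I
separated-refl _ _ (a∈I , a∉I) _ = contradiction a∈I a∉I

separated-tail : AllPairs _<_ (u ∷ I) → AllPairs _<_ (v ∷ J) →
                 MaxLtMin (u ∷ I) (v ∷ J) → MaxLtMin I J
separated-tail {u} {I} {v} {J} uI vJ sep a b (a∈I , a∉J) (b∈J , b∉I) with a ≟ v | b ≟ u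
... | yes refl | _        = head< vJ b∈J
... | no a≢v   | no b≢u   = sep a b (there a∈I , ∉-∷ a≢v a∉J) (there b∈J , ∉-∷ b≢u b∉I)
... | no a≢v   | yes refl =
  -- b = u lies above v, so v is in (v ∷ J) ∖ (u ∷ I) and a < v < b.
  <-trans (sep a v (there a∈I , ∉-∷ a≢v a∉J) (here refl , v∉uI)) (head< vJ b∈J)
  where
  v∉uI : v ∉ u ∷ I
  v∉uI v∈uI = <⇒≱ (head< vJ b∈J) (head≤ uI v∈uI)

pointwise-∈ : ∀ {a b r} {X : Set a} {Y : Set b} {R : X → Y → Set r} {xs ys y} →
              Pointwise R xs ys → y ∈ ys → ∃[ x ] x ∈ xs × R x y
pointwise-∈ (r ∷ _)  (here refl) = _ , here refl , r
pointwise-∈ (_ ∷ rs) (there y∈)  with pointwise-∈ rs y∈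
... | x , x∈ , r = x , there x∈ , r

separated⇒pointwise : AllPairs _<_ I → AllPairs _<_ J → length I ≡ length J →
                      MaxLtMin I J → Pointwise _≤_ I J
separated⇒pointwise {[]}    {[]}    _  _  _   _   = []
separated⇒pointwise {u ∷ I} {v ∷ J} uI vJ |I| sep = ≮⇒≥ v≮u ∷ I≤J
  where
  I≤J : Pointwise _≤_ I J
  I≤J = separated⇒pointwise (AllPairs.tail uI) (AllPairs.tail vJ) (suc-injective |I|)
          (separated-tail uI vJ sep)
  v≮u : ¬ v < u
  v≮u v<u with u ∈? v ∷ J
  ... | no u∉vJ = <-asym v<u (sep u v (here refl , u∉vJ) (here refl , v∉uI))
    where
    v∉uI : v ∉ u ∷ I
    v∉uI v∈uI = <⇒≱ v<u (head≤ uI v∈uI)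
  ... | yes (here refl) = <-irrefl refl v<u
  ... | yes (there u∈J) with pointwise-∈ I≤J u∈J
  ...   | x , x∈I , x≤u = <⇒≱ (head< uI x∈I) x≤u

step-leaves : MonotoneStep B A x y → y ∈ B ∖ A
step-leaves (_ , leaves , _) = proj₂ (leaves _) refl

step-enters : MonotoneStep B A x y → x ∈ A ∖ B
step-enters (enters , _ , _) = proj₂ (enters _) refl

step-keeps : MonotoneStep B A x y → z ≢ y → z ∈ B → z ∈ A
step-keeps {A = A} {z = z} (_ , leaves , _) z≢y z∈B with z ∈? A
... | yes z∈A = z∈A
... | no  z∉A = contradiction (proj₁ (leaves z) (z∈B , z∉A)) z≢y

step-keeps⁻ : MonotoneStep B A x y → z ≢ x → z ∈ A → z ∈ B
step-keeps⁻ {B = B} {z = z} (enters , _ , _) z≢x z∈A with z ∈? B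
... | yes z∈B = z∈B
... | no  z∉B = contradiction (proj₁ (enters z) (z∈A , z∉B)) z≢x

step-separated : MonotoneStep B A x y → MaxLtMin B A
step-separated (enters , leaves , y<x) a b a∈B∖A b∈A∖B =
  subst₂ _<_ (sym (proj₁ (leaves a) a∈B∖A)) (sym (proj₁ (enters b) b∈A∖B)) y<x

module _ {a ℓ} {X : Set a} {R : X → X → Set ℓ} (R-refl : Reflexive R) (R-trans : Transitive R) where

  steps⇒monotone : ∀ {N} (f : Fin (suc N) → X) → (∀ j → R (f (inject₁ j)) (f (suc j))) →
                   ∀ {s t} → s Fin.≤ t → R (f s) (f t)
  steps⇒monotone f step {zero}  {zero}  _         = R-refl
  steps⇒monotone {suc N} f step {zero}  {suc t} _ =
    R-trans (step zero) (steps⇒monotone (f ∘ suc) (step ∘ suc) {zero} {t} z≤n)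
  steps⇒monotone {suc N} f step {suc s} {suc t} (s≤s s≤t) =
    steps⇒monotone (f ∘ suc) (step ∘ suc) s≤t

arcEdge⇒step : ∀ {N} {A : Fin (suc N) → FinSet} {p q} → p < q → ArcEdge A p q →
               ∃[ a ] MonotoneStep (A (inject₁ a)) (A (suc a)) q p
arcEdge⇒step p<q (_ , _ , _ , step , inj₁ (refl , refl)) = contradiction (proj₂ (proj₂ step)) (<-asym p<q)
arcEdge⇒step p<q (a , _ , _ , step , inj₂ (refl , refl)) = a , step

module Path {n k N} {A : Fin (suc N) → FinSet} (P : MonotoneWSPath n k N A) where
  open MonotoneWSPath P

  increasing : ∀ s → AllPairs _<_ (A s)
  increasing s = proj₁ (kSubsets s)

  size : ∀ s → length (A s) ≡ k
  size s = proj₁ (proj₂ (kSubsets s))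

  same-size : ∀ s t → length (A s) ≡ length (A t)
  same-size s t = trans (size s) (sym (size t))

  pointwise-along : ∀ {s t} → s Fin.≤ t → Pointwise _≤_ (A s) (A t)
  pointwise-along = steps⇒monotone {R = Pointwise _≤_} (Pointwise.refl ≤-refl) (Pointwise.transitive ≤-trans) A
    λ j → separated⇒pointwise (increasing (inject₁ j)) (increasing (suc j)) (same-size (inject₁ j) (suc j))
            (step-separated (proj₂ (proj₂ (steps j))))

  -- Weak separation leaves two orientations; the other one would force A s = A t by antisymmetry.
  separated-along : ∀ {s t} → s Fin.≤ t → MaxLtMin (A s) (A t)
  separated-along {s} {t} s≤t with s Fin.≟ t
  ... | yes refl = separated-refl
  ... | no s≢t with pairwiseWS s t s≢t
  ...   | _      , inj₁ sep = sep
  ...   | As≢At , inj₂ sep = contradiction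
          (Pointwise.Pointwise-≡⇒≡ (Pointwise.antisymmetric ≤-antisym (pointwise-along s≤t)
             (separated⇒pointwise (increasing t) (increasing s) (same-size t s) sep)))
          As≢At

words : ∀ {a} {X : Set a} → ℕ → List X → List (List X)
words zero    xs = [ [] ]
words (suc k) xs = cartesianProductWith _∷_ xs (words k xs)

∈-words : ∀ {a} {X : Set a} {xs ys : List X} → All (_∈ xs) ys → ys ∈ words (length ys) xs
∈-words []             = here refl
∈-words (y∈xs ∷ ys∈xs) = ∈-cartesianProductWith⁺ _∷_ y∈xs (∈-words ys∈xs)

allPairs-universal : ∀ {a r} {X : Set a} {R : X → X → Set r} → (∀ x y → R x y) → ∀ xs → AllPairs R xs
allPairs-universal R-all []       = []
allPairs-universal R-all (x ∷ xs) = All.universal (R-all x) xs ∷ allPairs-universal R-all xs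

module Backtracking {a r} {X : Set a} {R : X → X → Set r} (R? : Decidable R) where

  extendable : List X → List (List X) → Bool
  extendable chosen []         = true
  extendable chosen (xs ∷ xss) =
    any (λ x → all (λ c → isYes (R? c x)) chosen ∧ extendable (x ∷ chosen) xss) xs

  extendable-complete : ∀ {chosen xss ys} → All (λ y → All (λ c → R c y) chosen) ys →
                        Pointwise _∈_ ys xss → AllPairs R ys → T (extendable chosen xss)
  extendable-complete _ [] [] = _
  extendable-complete (y-fits ∷ ys-fit) (y∈xs ∷ ys∈xss) (y-R ∷ ys-R) =
    any⁺ _ (lose y∈xs (Equivalence.from T-∧
      ( all⁻ _ (All.map (λ {c} Rcy → fromWitness {a? = R? c _} Rcy) y-fits)
      , extendable-complete (All.zipWith (λ (Ryz , fits) → Ryz ∷ fits) (y-R , ys-fit)) ys∈xss ys-R )))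

  choice⇒extendable : ∀ {xss ys} → Pointwise _∈_ ys xss → AllPairs R ys → T (extendable [] xss)
  choice⇒extendable = extendable-complete (All.universal (λ _ → []) _)

-- A window of width w starting at i: the element i + a is coded suc a, everything left of the
-- window is coded 0 and everything right of it suc w.
module Window (w : ℕ) where

  code : Fin w → ℕ
  code a = suc (toℕ a)

  clamp : ℕ → ℕ → ℕ
  clamp i z = (suc z ∸ i) ⊓ suc w

  shape : ℕ → FinSet → List ℕ
  shape i = map (clamp i)

  Collapsed : ℕ → Set
  Collapsed c = c ≡ 0 ⊎ c ≡ suc w

  clamp-mono : ∀ i → z ≤ z′ → clamp i z ≤ clamp i z′
  clamp-mono i z≤z′ = ⊓-monoˡ-≤ (suc w) (∸-monoˡ-≤ i (s≤s z≤z′))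

  clamp<2+w : ∀ i z → clamp i z < 2 + w
  clamp<2+w i z = s≤s (m⊓n≤n _ (suc w))

  cap-cases : ∀ m → Collapsed (m ⊓ suc w) ⊎ ∃[ a ] m ⊓ suc w ≡ code a
  cap-cases zero = inj₁ (inj₁ refl)
  cap-cases (suc m) with m <? w
  ... | yes m<w = inj₂ (fromℕ< m<w , cong suc (trans (m≤n⇒m⊓n≡m (<⇒≤ m<w)) (sym (Fin.toℕ-fromℕ< m<w))))
  ... | no  m≮w = inj₁ (inj₂ (cong suc (m≥n⇒m⊓n≡n (≮⇒≥ m≮w))))

  cap≡code⇒ : ∀ m a → m ⊓ suc w ≡ code a → m ≡ code a
  cap≡code⇒ (suc m) a eq with ⊓-sel m w
  ... | inj₁ m⊓w≡m = trans (cong suc (sym m⊓w≡m)) eq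
  ... | inj₂ m⊓w≡w = contradiction (trans (sym m⊓w≡w) (suc-injective eq)) (<⇒≢ (Fin.toℕ<n a) ∘ sym)

  clamp-cases : ∀ i z → Collapsed (clamp i z) ⊎ ∃[ a ] clamp i z ≡ code a
  clamp-cases i z = cap-cases (suc z ∸ i)

  clamp-code : ∀ i (a : Fin w) → clamp i (i + toℕ a) ≡ code a
  clamp-code i a = begin
    (suc (i + toℕ a) ∸ i) ⊓ suc w   ≡⟨ cong (λ m → (m ∸ i) ⊓ suc w) (sym (+-suc i (toℕ a))) ⟩
    (i + code a ∸ i) ⊓ suc w       ≡⟨ cong (_⊓ suc w) (m+n∸m≡n i (code a)) ⟩
    code a ⊓ suc w                 ≡⟨ m≤n⇒m⊓n≡m (s≤s (<⇒≤ (Fin.toℕ<n a))) ⟩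
    code a                         ∎
    where open ≡-Reasoning

  clamp≡code⇒ : ∀ i a → clamp i z ≡ code a → z ≡ i + toℕ a
  clamp≡code⇒ {z} i a eq = begin
    z                   ≡⟨ sym (m+[n∸m]≡n i≤z) ⟩
    i + (z ∸ i)         ≡⟨ cong (i +_) (suc-injective (trans (sym (+-∸-assoc 1 i≤z)) [1+z]∸i≡code)) ⟩
    i + toℕ a           ∎
    where
    open ≡-Reasoning
    [1+z]∸i≡code : suc z ∸ i ≡ code a
    [1+z]∸i≡code = cap≡code⇒ (suc z ∸ i) a eq
    i≤z : i ≤ z
    i≤z = ≤-pred (m∸n≢0⇒n<m λ eq₀ → contradiction (trans (sym eq₀) [1+z]∸i≡code) λ ())

  -- Codes of distinct elements may coincide only outside the window.
  _⊑_ : ℕ → ℕ → Set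
  c ⊑ c′ = c ≤ c′ × (c ≡ c′ → Collapsed c)

  _⊑?_ : Decidable _⊑_
  c ⊑? c′ = c ≤? c′ ×-dec (c ≟ c′ →-dec (c ≟ 0 ⊎-dec c ≟ suc w))

  clamp-⊑ : ∀ i → z < z′ → clamp i z ⊑ clamp i z′
  clamp-⊑ {z} {z′} i z<z′ = clamp-mono i (<⇒≤ z<z′) , collapsed
    where
    collapsed : clamp i z ≡ clamp i z′ → Collapsed (clamp i z)
    collapsed eq with clamp-cases i z
    ... | inj₁ c           = c
    ... | inj₂ (a , z↦a) = contradiction
            (trans (clamp≡code⇒ i a z↦a) (sym (clamp≡code⇒ i a (trans (sym eq) z↦a))))
            (<⇒≢ z<z′)

  code∈shape⁺ : ∀ i a → i + toℕ a ∈ I → code a ∈ shape i I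
  code∈shape⁺ i a m = subst (_∈ _) (clamp-code i a) (∈-map⁺ (clamp i) m)

  code∈shape⁻ : ∀ i a → code a ∈ shape i I → i + toℕ a ∈ I
  code∈shape⁻ i a m with ∈-map⁻ (clamp i) m
  ... | z , z∈I , eq = subst (_∈ _) (clamp≡code⇒ i a (sym eq)) z∈I

  code∈shape∖⁺ : ∀ i a → (i + toℕ a) ∈ I ∖ J → code a ∈ shape i I ∖ shape i J
  code∈shape∖⁺ i a (m , m∉) = code∈shape⁺ i a m , m∉ ∘ code∈shape⁻ i a

  code∈shape∖⁻ : ∀ i a → code a ∈ shape i I ∖ shape i J → (i + toℕ a) ∈ I ∖ J
  code∈shape∖⁻ i a (m , m∉) = code∈shape⁻ i a m , m∉ ∘ code∈shape⁺ i a

  ∈∖? : ∀ c C D → Dec (c ∈ C ∖ D)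
  ∈∖? c C D = c ∈? C ×-dec ¬? (c ∈? D)

  WindowSeparated : List ℕ → List ℕ → Set
  WindowSeparated C D = ∀ a b → code a ∈ C ∖ D → code b ∈ D ∖ C → a Fin.< b

  Precedes♯ : List ℕ → List ℕ → Set
  Precedes♯ C D = Pointwise _≤_ C D × WindowSeparated C D

  precedes♯? : Decidable Precedes♯
  precedes♯? C D = Pointwise.decidable _≤?_ C D ×-dec
    Fin.all? λ a → Fin.all? λ b → ∈∖? (code a) C D →-dec ∈∖? (code b) D C →-dec a Fin.<? b

  shape-precedes : ∀ i → AllPairs _<_ I → AllPairs _<_ J → length I ≡ length J →
                   MaxLtMin I J → Precedes♯ (shape i I) (shape i J)
  shape-precedes i incI incJ |I| sep =
    Pointwise.map⁺ (clamp i) (clamp i) (Pointwise.map (clamp-mono i) (separated⇒pointwise incI incJ |I| sep)) ,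
    λ a b a∈ b∈ → +-cancelˡ-< i _ _ (sep _ _ (code∈shape∖⁻ i a a∈) (code∈shape∖⁻ i b b∈))

  AgreeOff : Fin w → Fin w → List ℕ → List ℕ → Set
  AgreeOff c d C D = ∀ e → e ≢ c → e ≢ d → (code e ∈ C → code e ∈ D) × (code e ∈ D → code e ∈ C)

  Step♯ : Fin w → Fin w → List ℕ × List ℕ → Set
  Step♯ c d (C , D) = code c ∈ C ∖ D × code d ∈ D ∖ C × Pointwise _≤_ C D × AgreeOff c d C D

  step♯? : ∀ c d → (CD : List ℕ × List ℕ) → Dec (Step♯ c d CD)
  step♯? c d (C , D) = ∈∖? (code c) C D ×-dec ∈∖? (code d) D C ×-dec Pointwise.decidable _≤?_ C D ×-dec
    Fin.all? λ e → ¬? (e Fin.≟ c) →-dec ¬? (e Fin.≟ d) →-dec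
      ((code e ∈? C →-dec code e ∈? D) ×-dec (code e ∈? D →-dec code e ∈? C))

  shapes : ℕ → List (List ℕ)
  shapes k = filter (allPairs? _⊑?_) (words k (upTo (2 + w)))

  steps♯ : ℕ → Fin w → Fin w → List (List ℕ × List ℕ)
  steps♯ k c d = filter (step♯? c d) (cartesianProduct (shapes k) (shapes k))

  -- Of two steps of one path, the earlier one ends in a set preceding the start of the later one.
  Compatible : List ℕ × List ℕ → List ℕ × List ℕ → Set
  Compatible (C , D) (C′ , D′) = Precedes♯ D C′ ⊎ Precedes♯ D′ C ⊎ (C , D) ≡ (C′ , D′)

  compatible? : Decidable Compatible
  compatible? (C , D) (C′ , D′) = precedes♯? D C′ ⊎-dec precedes♯? D′ C ⊎-dec
    Product.≡-dec (List.≡-dec _≟_) (List.≡-dec _≟_) (C , D) (C′ , D′)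

  shape∈shapes : ∀ i → AllPairs _<_ I → shape i I ∈ shapes (length I)
  shape∈shapes {I} i incI = ∈-filter⁺ (allPairs? _⊑?_)
    (subst (λ m → shape i I ∈ words m _) (length-map (clamp i) I)
      (∈-words (All-map⁺ (All.universal (λ z → ∈-upTo⁺ (clamp<2+w i z)) I))))
    (AllPairs.map⁺ (AllPairs.map (clamp-⊑ i) incI))

  shape-step : ∀ {k} i {c d : Fin w} → AllPairs _<_ B → AllPairs _<_ A → length B ≡ k → length A ≡ k →
               MonotoneStep B A (i + toℕ d) (i + toℕ c) → (shape i B , shape i A) ∈ steps♯ k c d
  shape-step {B} {A} i {c} {d} incB incA |B| |A| step = ∈-filter⁺ (step♯? c d)
    (∈-cartesianProduct⁺ (subst (λ m → _ ∈ shapes m) |B| (shape∈shapes i incB))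
                         (subst (λ m → _ ∈ shapes m) |A| (shape∈shapes i incA)))
    ( code∈shape∖⁺ i c (step-leaves step)
    , code∈shape∖⁺ i d (step-enters step)
    , proj₁ (shape-precedes i incB incA (trans |B| (sym |A|)) (step-separated step))
    , λ e e≢c e≢d → code∈shape⁺ i e ∘ step-keeps step (off e≢c) ∘ code∈shape⁻ i e
                  , code∈shape⁺ i e ∘ step-keeps⁻ step (off e≢d) ∘ code∈shape⁻ i e )
    where
    off : ∀ {e a} → e ≢ a → i + toℕ e ≢ i + toℕ a
    off e≢a = e≢a ∘ Fin.toℕ-injective ∘ +-cancelˡ-≡ i _ _

module WindowedPath {n k N} {A : Fin (suc N) → FinSet} (P : MonotoneWSPath n k N A) (w i : ℕ) where
  open Path P
  open Window w

  step♯ : Fin N → List ℕ × List ℕ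
  step♯ a = shape i (A (inject₁ a)) , shape i (A (suc a))

  step♯-precedes : ∀ {a b} → a Fin.< b → Precedes♯ (shape i (A (suc a))) (shape i (A (inject₁ b)))
  step♯-precedes {a} {b} a<b = shape-precedes i (increasing _) (increasing _) (same-size _ _)
    (separated-along (subst (suc (toℕ a) ≤_) (sym (Fin.toℕ-inject₁ b)) a<b))

  step♯-compatible : ∀ a b → Compatible (step♯ a) (step♯ b)
  step♯-compatible a b with Fin.<-cmp a b
  ... | tri< a<b _ _ = inj₁ (step♯-precedes a<b)
  ... | tri≈ _ refl _ = inj₂ (inj₂ refl)
  ... | tri> _ _ b<a = inj₂ (inj₁ (step♯-precedes b<a))

  arcEdge♯ : ∀ (c d : Fin w) {c<d : True (toℕ c <? toℕ d)} →
             ArcEdge A (i + toℕ c) (i + toℕ d) → ∃[ a ] step♯ a ∈ steps♯ k c d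
  arcEdge♯ c d {c<d} edge with arcEdge⇒step {A = A} (+-monoʳ-< i (toWitness c<d)) edge
  ... | a , step = a , shape-step i (increasing (inject₁ a)) (increasing (suc a)) (size _) (size _) step

open Window 6 using (steps♯; Compatible; compatible?)

ladder♯ : List (List (List ℕ × List ℕ))
ladder♯ = steps♯ 3 (# 3) (# 4) ∷ steps♯ 3 (# 2) (# 4) ∷ steps♯ 3 (# 3) (# 5) ∷ steps♯ 3 (# 4) (# 5) ∷
          steps♯ 3 (# 0) (# 2) ∷ steps♯ 3 (# 1) (# 2) ∷ steps♯ 3 (# 1) (# 3) ∷ steps♯ 3 (# 0) (# 1) ∷ []

-- The search evaluates to false, so T (extendable [] ladder♯) normalises to ⊥.
noLadder♯ : ∀ {Ps} → Pointwise _∈_ Ps ladder♯ → ¬ AllPairs Compatible Ps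
noLadder♯ = Backtracking.choice⇒extendable compatible?

module _ {n N} {A : Fin (suc N) → FinSet} (P : MonotoneWSPath n 3 N A) (i : ℕ) where
  open WindowedPath P 6 i

  noLadder : ∀ {as} → ¬ Pointwise (λ a Ps → step♯ a ∈ Ps) as ladder♯
  noLadder {as} steps∈ladder = noLadder♯ (Pointwise.map⁺ step♯ (λ Ps → Ps) steps∈ladder)
    (AllPairs.map⁺ (allPairs-universal step♯-compatible as))

proposition3p16 : (n N : ℕ) → 3 ≤ n → (A : Fin (suc N) → FinSet) →
    MonotoneWSPath n 3 N A →
    A zero ≡ 1 ∷ 2 ∷ 3 ∷ [] →
    A (fromℕ N) ≡ n ∸ 2 ∷ n ∸ 1 ∷ n ∷ [] →
    (i : ℕ) → ¬ (ArcEdge A i (i + 1) × ArcEdge A (i + 1) (i + 2) × ArcEdge A (i + 2) (i + 3) ×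
                 ArcEdge A (i + 3) (i + 4) × ArcEdge A (i + 4) (i + 5) ×
                 ArcEdge A i (i + 2) × ArcEdge A (i + 1) (i + 3) ×
                 ArcEdge A (i + 2) (i + 4) × ArcEdge A (i + 3) (i + 5))
proposition3p16 n N _ A P _ _ i (e01 , e12 , _ , e34 , e45 , e02 , e13 , e24 , e35) =
  noLadder P i
    ( proj₂ (arcEdge♯ (# 3) (# 4) e34) ∷ proj₂ (arcEdge♯ (# 2) (# 4) e24)
    ∷ proj₂ (arcEdge♯ (# 3) (# 5) e35) ∷ proj₂ (arcEdge♯ (# 4) (# 5) e45)
    ∷ proj₂ (arcEdge♯ (# 0) (# 2) (from-i e02)) ∷ proj₂ (arcEdge♯ (# 1) (# 2) e12)
    ∷ proj₂ (arcEdge♯ (# 1) (# 3) e13) ∷ proj₂ (arcEdge♯ (# 0) (# 1) (from-i e01)) ∷ [] )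
  where
  open WindowedPath P 6 i
  from-i : ∀ {q} → ArcEdge A i q → ArcEdge A (i + 0) q
  from-i = subst (λ p → ArcEdge A p _) (sym (+-identityʳ i))
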